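{- Let $n$ be a positive integer and $d\in\Delta(n)$. Write $L$ for the largest index with $d_L>0$ and let $q$ be the integer with $d_i=i$ for $1\le i\le q$ and $d_{q+1}\le q$. Set $b_i=d_i-d_{i+1}$ for $q\le i<L$ and $b_L=d_L$. Then the number of partitions $\alpha\in\mathcal{P}(n)$ with exactly $q$ parts and $\delta(\alpha)=d$ is \[ \big|[\,d\,]_q\big|=\big|[\,d\,]\cap\mathcal{P}(n,q)\big|=\prod_{i=q}^{L-1}\binom{b_i+b_{i+1}}{b_i}. \]
   Context: $\mathcal{P}(n)$ is the set of partitions $\alpha=(\alpha_1\ge\dots\ge\alpha_t\ge1)$ of $n$ (with $\alpha_i=0$ for $i>t$), and $\mathcal{P}(n,k)$ the set of those with exactly $k$ nonzero parts. The diagonal sequence is $\delta(\alpha)=(d_k)_{k\ge1}$ with $d_k=\big|\{i:1\le i\le k,\ \alpha_i+i-1\ge k\}\big|$; $\Delta(n)=\{\delta(\alpha):\alpha\in\mathcal{P}(n)\}$; $[\,d\,]=\{\alpha\in\mathcal{P}(n):\delta(\alpha)=d\}$ and $[\,d\,]_k=[\,d\,]\cap\mathcal{P}(n,k)$. Every diagonal sequence begins $1,2,\dots,q$ and is non-increasing afterwards, so $q$ is well defined. An empty product equals $1$. -}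

module Defs where

open import Data.Nat using (ℕ; zero; suc; _+_; _*_; _∸_; _≤_; _<_; _≥_; _≤?_; _<ᵇ_)
open import Data.Nat.Combinatorics using (_C_)
open import Data.Bool using (if_then_else_)
open import Data.List using (List; []; _∷_; length; filter; applyUpTo)
open import Data.Nat.ListAction using (sum; product)
open import Data.List.Relation.Unary.All using (All)
open import Data.List.Relation.Unary.Linked using (Linked)
open import Data.List.Relation.Unary.Unique.Propositional using (Unique)
open import Data.List.Membership.Propositional using (_∈_)
open import Data.Product using (_×_; ∃-syntax)
open import Function.Bundles using (_⇔_)
open import Relation.Binary.PropositionalEquality using (_≡_)

IsPartition : ℕ → List ℕ → Set
IsPartition n α = Linked _≥_ α × All (1 ≤_) α × sum α ≡ n

numParts : List ℕ → ℕ
numParts = length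

-- α_i, 1-indexed, with α_i = 0 beyond the last part (index 0 unused, returns 0).
part : List ℕ → ℕ → ℕ
part []       _             = 0
part (x ∷ xs) zero          = 0
part (x ∷ xs) (suc zero)    = x
part (x ∷ xs) (suc (suc i)) = part xs (suc i)

-- Diagonal sequence: δ α k = |{ i : 1 ≤ i ≤ k , α_i + i - 1 ≥ k }|  (meaningful for k ≥ 1).
δ : List ℕ → ℕ → ℕ
δ α k = length (filter (λ i → k ≤? part α i + (i ∸ 1)) (applyUpTo suc k))

_≈ₛ_ : (ℕ → ℕ) → (ℕ → ℕ) → Set
d ≈ₛ e = ∀ k → 1 ≤ k → d k ≡ e k

InΔ : ℕ → (ℕ → ℕ) → Set
InΔ n d = ∃[ α ] (IsPartition n α × δ α ≈ₛ d)

bseq : (ℕ → ℕ) → ℕ → ℕ → ℕ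
bseq d L i = if i <ᵇ L then d i ∸ d (suc i) else d L

prodRange : ℕ → ℕ → (ℕ → ℕ) → ℕ
prodRange a b f = product (applyUpTo (λ j → f (a + j)) (b ∸ a))

HasCount : (List ℕ → Set) → ℕ → Set
HasCount P m = ∃[ xs ] (Unique xs × (∀ α → (α ∈ xs) ⇔ P α) × length xs ≡ m)

-- For a partition α with q parts put βᵢ = αᵢ + i − 1.  When d_q = q every βᵢ is at least q, and
-- then d_{q+j} is the number of i with βᵢ ≥ q + j.  Partitions correspond exactly to sequences β
-- that rise by at most one at each step, so α ↦ β − q is a bijection from [d]_q onto the words γ of
-- length q with that property and with exactly t_j = d_{q+j} entries ≥ j (the size n is automatic,
-- since |α| is the sum of δ(α)).  Such words are counted one level at a time: deleting the zeros of
-- γ and decrementing the rest gives a word for the profile (t_{j+1}), and because a 0 can only be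
-- followed by a 0 or a 1, the zeros sit in runs in front of the 1s or at the end.  The pattern of 0s
-- and 1s is therefore an arbitrary shuffle of b_q zeros and b_{q+1} ones, contributing the factor
-- binomial(b_q + b_{q+1}, b_q).  That d is non-increasing after q, needed for these counts, is read off
-- from any partition witnessing d ∈ Δ(n).
module Submission where

open import Defs
open import Level using (0ℓ)
open import Data.Bool using (Bool; true; false; T)
open import Data.Empty using (⊥; ⊥-elim)
open import Data.Nat
  using (ℕ; zero; suc; _+_; _*_; _∸_; _≤_; _<_; _≥_; _≤?_; _<ᵇ_; z≤n; s≤s; z<s)
open import Data.Nat using (_≤′_; ≤′-refl; ≤′-step)
open import Data.Nat.Properties
open import Data.Nat.Combinatorics using (_C_; nCn≡1; nCk+nC[k+1]≡[n+1]C[k+1])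
open import Data.Nat.ListAction using (sum; product)
open import Data.List using (List; []; _∷_; length; map; filter; replicate; applyUpTo; cartesianProduct; _++_)
open import Data.List.Properties using (length-map; length-++; length-replicate; ∷-injectiveʳ; filter-none)
open import Data.List.Relation.Unary.Any using (here; there)
open import Data.List.Relation.Unary.All as All using (All; []; _∷_)
import Data.List.Relation.Unary.All.Properties as All
open import Data.List.Relation.Unary.Linked as Linked using (Linked; []; [-]; _∷_)
import Data.List.Relation.Unary.Linked.Properties as Linked
open import Data.List.Relation.Unary.Unique.Propositional using (Unique; []; _∷_)
import Data.List.Relation.Unary.Unique.Propositional.Properties as Unique
open import Data.List.Membership.Propositional using (_∈_)
open import Data.List.Membership.Propositional.Properties
  using (∈-map⁺; ∈-map⁻; ∈-++⁺ˡ; ∈-++⁺ʳ; ∈-++⁻; ∈-cartesianProduct⁺; ∈-cartesianProduct⁻)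
open import Data.Product using (_×_; _,_; proj₁; proj₂; map₁; map₂; uncurry)
open import Data.Sum using (inj₁; inj₂)
open import Function.Bundles using (_⇔_; mk⇔; Equivalence)
open import Relation.Binary.Definitions using (tri<; tri≈; tri>)
open import Relation.Binary.PropositionalEquality
open import Relation.Nullary using (yes; no; does; contradiction)
open import Relation.Unary using (Pred; Decidable)
open import Algebra.Properties.CommutativeSemigroup +-commutativeSemigroup using (interchange)

χ : Bool → ℕ
χ true  = 1
χ false = 0

length-filter-∷ : ∀ {P : Pred ℕ 0ℓ} (P? : Decidable P) y ys →
  length (filter P? (y ∷ ys)) ≡ χ (does (P? y)) + length (filter P? ys)
length-filter-∷ P? y ys with does (P? y)
... | true  = refl
... | false = refl

module _ {P Q : Pred ℕ 0ℓ} (P? : Decidable P) (Q? : Decidable Q) where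

  length-filter-applyUpTo-cong : ∀ k f g → (∀ {j} → j < k → P (f j) ⇔ Q (g j)) →
    length (filter P? (applyUpTo f k)) ≡ length (filter Q? (applyUpTo g k))
  length-filter-applyUpTo-cong zero    f g P⇔Q = refl
  length-filter-applyUpTo-cong (suc k) f g P⇔Q
    with P? (f 0) | Q? (g 0)
       | length-filter-applyUpTo-cong k (λ j → f (suc j)) (λ j → g (suc j)) (λ j<k → P⇔Q (s≤s j<k))
  ... | yes _  | yes _  | ih = cong suc ih
  ... | no _   | no _   | ih = ih
  ... | yes p  | no ¬q  | _  = contradiction (Equivalence.to   (P⇔Q z<s) p) ¬q
  ... | no ¬p  | yes q  | _  = contradiction (Equivalence.from (P⇔Q z<s) q) ¬p

applyUpTo-cong : ∀ {A : Set} (f g : ℕ → A) n → (∀ {j} → j < n → f j ≡ g j) → applyUpTo f n ≡ applyUpTo g n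
applyUpTo-cong f g zero    f≡g = refl
applyUpTo-cong f g (suc n) f≡g =
  cong₂ _∷_ (f≡g z<s) (applyUpTo-cong (λ j → f (suc j)) (λ j → g (suc j)) n (λ j<n → f≡g (s≤s j<n)))

sum-applyUpTo-+ : ∀ f g n → sum (applyUpTo (λ k → f k + g k) n) ≡ sum (applyUpTo f n) + sum (applyUpTo g n)
sum-applyUpTo-+ f g zero    = refl
sum-applyUpTo-+ f g (suc n) =
  trans (cong (f 0 + g 0 +_) (sum-applyUpTo-+ (λ k → f (suc k)) (λ k → g (suc k)) n))
        (interchange (f 0) (g 0) _ _)

Unique-map⁺-onInverse : ∀ {A B : Set} (f : A → B) (g : B → A) {xs : List A} → Unique xs →
  (∀ {x} → x ∈ xs → g (f x) ≡ x) → Unique (map f xs)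
Unique-map⁺-onInverse f g {[]}     []         _   = []
Unique-map⁺-onInverse f g {x ∷ xs} (x∉ ∷ uxs) inv =
  All.map⁺ (All.tabulate (λ y∈ fx≡fy →
    All.lookup x∉ y∈ (trans (sym (inv (here refl))) (trans (cong g fx≡fy) (inv (there y∈))))))
  ∷ Unique-map⁺-onInverse f g uxs (λ x∈ → inv (there x∈))

length-cartesianProduct : ∀ {A B : Set} (xs : List A) (ys : List B) →
  length (cartesianProduct xs ys) ≡ length xs * length ys
length-cartesianProduct []       ys = refl
length-cartesianProduct (x ∷ xs) ys =
  trans (length-++ (map (x ,_) ys)) (cong₂ _+_ (length-map (x ,_) ys) (length-cartesianProduct xs ys))

χ≤1 : ∀ b → χ b ≤ 1
χ≤1 true  = ≤-refl
χ≤1 false = z≤n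

χ<ᵇ-antitone : ∀ k x → χ (suc k <ᵇ x) ≤ χ (k <ᵇ x)
χ<ᵇ-antitone k       zero    = z≤n
χ<ᵇ-antitone zero    (suc x) = χ≤1 (0 <ᵇ x)
χ<ᵇ-antitone (suc k) (suc x) = χ<ᵇ-antitone k x

≤⇒χ<ᵇ≡0 : ∀ {x k} → x ≤ k → χ (k <ᵇ x) ≡ 0
≤⇒χ<ᵇ≡0 z≤n       = refl
≤⇒χ<ᵇ≡0 (s≤s x≤k) = ≤⇒χ<ᵇ≡0 x≤k

<⇒χ<ᵇ≡1 : ∀ {k x} → k < x → χ (k <ᵇ x) ≡ 1
<⇒χ<ᵇ≡1 (s≤s z≤n)         = refl
<⇒χ<ᵇ≡1 (s≤s (s≤s k<x))   = <⇒χ<ᵇ≡1 (s≤s k<x)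

sum-applyUpTo-χ<ᵇ : ∀ {x n} → x ≤ n → sum (applyUpTo (λ k → χ (k <ᵇ x)) n) ≡ x
sum-applyUpTo-χ<ᵇ {zero}  {n}     _         = sum-applyUpTo-zero n
  where
  sum-applyUpTo-zero : ∀ n → sum (applyUpTo (λ _ → 0) n) ≡ 0
  sum-applyUpTo-zero zero    = refl
  sum-applyUpTo-zero (suc n) = sum-applyUpTo-zero n
sum-applyUpTo-χ<ᵇ {suc x} {suc n} (s≤s x≤n) = cong suc (sum-applyUpTo-χ<ᵇ x≤n)

<ᵇ-cancelˡ : ∀ o k x → (o + k <ᵇ o + x) ≡ (k <ᵇ x)
<ᵇ-cancelˡ zero    k x = refl
<ᵇ-cancelˡ (suc o) k x = <ᵇ-cancelˡ o k x

All-≤-map-+ : ∀ q γ → All (q ≤_) (map (q +_) γ)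
All-≤-map-+ q []      = []
All-≤-map-+ q (y ∷ γ) = m≤m+n q y ∷ All-≤-map-+ q γ

map-+-map-∸ : ∀ q β → All (q ≤_) β → map (q +_) (map (_∸ q) β) ≡ β
map-+-map-∸ q []      _        = refl
map-+-map-∸ q (y ∷ β) (p ∷ ps) = cong₂ _∷_ (m+[n∸m]≡n p) (map-+-map-∸ q β ps)

map-∸-map-+ : ∀ q γ → map (_∸ q) (map (q +_) γ) ≡ γ
map-∸-map-+ q []      = refl
map-∸-map-+ q (y ∷ γ) = cong₂ _∷_ (m+n∸m≡n q y) (map-∸-map-+ q γ)

-- The diagonal sequence

δʳ : List ℕ → ℕ → ℕ
δʳ []      k       = 0
δʳ (x ∷ α) zero    = 0
δʳ (x ∷ α) (suc k) = χ (k <ᵇ x) + δʳ α k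

δ≗δʳ : ∀ α k → δ α k ≡ δʳ α k
δ≗δʳ []      k       = cong length (filter-none _ (All.applyUpTo⁺₁ suc k (λ i<k → <⇒≱ i<k)))
δ≗δʳ (x ∷ α) zero    = refl
δ≗δʳ (x ∷ α) (suc k) = begin
  δ (x ∷ α) (suc k)
    ≡⟨ length-filter-∷ (λ i → suc k ≤? part (x ∷ α) i + (i ∸ 1)) 1 _ ⟩
  χ (k <ᵇ x + 0) + length (filter (λ i → suc k ≤? part (x ∷ α) i + (i ∸ 1)) (applyUpTo (λ j → suc (suc j)) k))
    ≡⟨ cong₂ (λ a b → χ (k <ᵇ a) + b) (+-identityʳ x)
         (length-filter-applyUpTo-cong _ (λ i → k ≤? part α i + (i ∸ 1)) k (λ j → suc (suc j)) suc
                                       (λ _ → shifted _)) ⟩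
  χ (k <ᵇ x) + δ α k
    ≡⟨ cong (χ (k <ᵇ x) +_) (δ≗δʳ α k) ⟩
  δʳ (x ∷ α) (suc k) ∎
  where
  open ≡-Reasoning
  shifted : ∀ j → (suc k ≤ part α (suc j) + suc j) ⇔ (k ≤ part α (suc j) + j)
  shifted j = mk⇔ (λ h → ≤-pred (≤-trans h (≤-reflexive (+-suc (part α (suc j)) j))))
                  (λ h → ≤-trans (s≤s h) (≤-reflexive (sym (+-suc (part α (suc j)) j))))

≈ₛ-δʳ : ∀ α {d} → δ α ≈ₛ d → δʳ α ≈ₛ d
≈ₛ-δʳ α δα≈d k k≥1 = trans (sym (δ≗δʳ α k)) (δα≈d k k≥1)

δʳ-zero : ∀ α → δʳ α 0 ≡ 0
δʳ-zero []      = refl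
δʳ-zero (x ∷ α) = refl

δ-one : ∀ {n} α → 1 ≤ n → IsPartition n α → δ α 1 ≡ 1
δ-one []      n≥1 (_ , _ , refl)    = contradiction n≥1 λ ()
δ-one (x ∷ α) _   (_ , x≥1 ∷ _ , _) = trans (δ≗δʳ (x ∷ α) 1) (cong₂ _+_ (<⇒χ<ᵇ≡1 x≥1) (δʳ-zero α))

δʳ-suc≤ : ∀ α k → δʳ α (suc k) ≤ suc (δʳ α k)
δʳ-suc≤ []      k       = z≤n
δʳ-suc≤ (x ∷ α) zero    rewrite δʳ-zero α = ≤-trans (≤-reflexive (+-identityʳ _)) (χ≤1 (0 <ᵇ x))
δʳ-suc≤ (x ∷ α) (suc k) = ≤-trans (+-mono-≤ (χ<ᵇ-antitone k x) (δʳ-suc≤ α k)) (≤-reflexive (+-suc _ _))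

-- Exits α k: some i ≤ k + 1 has α_i + i − 1 ≤ k (counting α_i = 0 past the last part).
data Exits : List ℕ → ℕ → Set where
  []    : ∀ {k} → Exits [] k
  here  : ∀ {x α k} → x ≤ k → Exits (x ∷ α) k
  there : ∀ {x α k} → Exits α k → Exits (x ∷ α) (suc k)

Exits-suc : ∀ {α k} → Exits α k → Exits α (suc k)
Exits-suc []        = []
Exits-suc (here x≤k) = here (m≤n⇒m≤1+n x≤k)
Exits-suc (there e) = there (Exits-suc e)

Exits-mono : ∀ {α k l} → k ≤ l → Exits α k → Exits α l
Exits-mono k≤l e = go (≤⇒≤′ k≤l)
  where
  go : ∀ {l} → _ ≤′ l → Exits _ l
  go ≤′-refl        = e
  go (≤′-step k≤′l) = Exits-suc (go k≤′l)

Exits-intro : ∀ α k → δʳ α (suc k) ≤ k → Exits α k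
Exits-intro []      k h = []
Exits-intro (x ∷ α) k h with x ≤? k
... | yes x≤k = here x≤k
... | no  x≰k = go k (≤-trans (≤-reflexive (cong (_+ δʳ α k) (sym (<⇒χ<ᵇ≡1 (≰⇒> x≰k))))) h)
  where
  go : ∀ k → suc (δʳ α k) ≤ k → Exits (x ∷ α) k
  go (suc k) h = there (Exits-intro α k (≤-pred h))

δʳ-antitone-at : ∀ {α k} → Linked _≥_ α → Exits α k → δʳ α (suc k) ≤ δʳ α k
δʳ-antitone-at {[]}    _   _ = z≤n
δʳ-antitone-at {x ∷ α} {zero} _ (here z≤n) rewrite δʳ-zero α = z≤n
δʳ-antitone-at {x ∷ α} {suc k} lin e with <-cmp x (suc k)
... | tri< x<sk _ _ rewrite ≤⇒χ<ᵇ≡0 (<⇒≤ x<sk) | ≤⇒χ<ᵇ≡0 (≤-pred x<sk) =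
  δʳ-antitone-at (Linked.tail lin) (tail-exits lin)
  where
  tail-exits : ∀ {α} → Linked _≥_ (x ∷ α) → Exits α k
  tail-exits {[]}    _           = []
  tail-exits {y ∷ α} (y≤x ∷ _) = here (≤-trans y≤x (≤-pred x<sk))
... | tri≈ _ refl _ rewrite ≤⇒χ<ᵇ≡0 (≤-refl {suc k}) | <⇒χ<ᵇ≡1 (n<1+n k) = δʳ-suc≤ α k
... | tri> _ _ sk<x with e
...   | here x≤sk = contradiction x≤sk (<⇒≱ sk<x)
...   | there e′ rewrite <⇒χ<ᵇ≡1 sk<x | <⇒χ<ᵇ≡1 (<-trans (n<1+n k) sk<x) =
  s≤s (δʳ-antitone-at (Linked.tail lin) e′)

δʳ-antitone : ∀ {α q k} → Linked _≥_ α → δʳ α (suc q) ≤ q → q ≤ k → δʳ α (suc k) ≤ δʳ α k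
δʳ-antitone {α} {q} lin δq≤q q≤k = δʳ-antitone-at lin (Exits-mono q≤k (Exits-intro α q δq≤q))

-- Summing δ along the diagonals counts every cell of the Young diagram once.
sum≡Σδʳ : ∀ α n → sum α + length α ≤ n → sum α ≡ sum (applyUpTo (λ k → δʳ α (suc k)) n)
sum≡Σδʳ []      n       _ = sym (sum-applyUpTo-χ<ᵇ {0} {n} z≤n)
sum≡Σδʳ (x ∷ α) zero    h = contradiction (m+n≤o⇒n≤o (x + sum α) h) λ ()
sum≡Σδʳ (x ∷ α) (suc n) h = begin
  x + sum α
    ≡⟨ cong₂ _+_ (sym (sum-applyUpTo-χ<ᵇ x≤1+n)) (sum≡Σδʳ α n tail-bound) ⟩
  Σχ + Σtail
    ≡⟨ cong (λ z → Σχ + (z + Σtail)) (sym (δʳ-zero α)) ⟩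
  Σχ + sum (applyUpTo (δʳ α) (suc n))
    ≡⟨ sym (sum-applyUpTo-+ (λ k → χ (k <ᵇ x)) (δʳ α) (suc n)) ⟩
  sum (applyUpTo (λ k → δʳ (x ∷ α) (suc k)) (suc n)) ∎
  where
  open ≡-Reasoning
  Σχ Σtail : ℕ
  Σχ    = sum (applyUpTo (λ k → χ (k <ᵇ x)) (suc n))
  Σtail = sum (applyUpTo (λ k → δʳ α (suc k)) n)
  h′ : x + (sum α + length α) ≤ n
  h′ = ≤-pred (subst (_≤ suc n) (trans (+-suc (x + sum α) (length α)) (cong suc (+-assoc x (sum α) (length α)))) h)
  x≤1+n : x ≤ suc n
  x≤1+n = m≤n⇒m≤1+n (≤-trans (m≤m+n x _) h′)
  tail-bound : sum α + length α ≤ n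
  tail-bound = ≤-trans (m≤n+m _ x) h′

δ-≈ₛ⇒sum-≡ : ∀ α β → δ α ≈ₛ δ β → sum α ≡ sum β
δ-≈ₛ⇒sum-≡ α β δα≈δβ = begin
  sum α                                        ≡⟨ sum≡Σδʳ α N (m≤m+n (sum α + length α) _) ⟩
  sum (applyUpTo (λ k → δʳ α (suc k)) N)       ≡⟨ cong sum (applyUpTo-cong _ _ N δα≡δβ) ⟩
  sum (applyUpTo (λ k → δʳ β (suc k)) N)       ≡⟨ sym (sum≡Σδʳ β N (m≤n+m _ (sum α + length α))) ⟩
  sum β                                        ∎
  where
  open ≡-Reasoning
  N : ℕ
  N = (sum α + length α) + (sum β + length β)
  δα≡δβ : ∀ {k} → k < N → δʳ α (suc k) ≡ δʳ β (suc k)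
  δα≡δβ {k} _ = trans (≈ₛ-δʳ α δα≈δβ (suc k) (s≤s z≤n)) (δ≗δʳ β (suc k))

-- Diagonal coordinates

count≥ : ℕ → List ℕ → ℕ
count≥ k []       = 0
count≥ k (y ∷ ys) = χ (k <ᵇ suc y) + count≥ k ys

-- For o = 0 the entries are the βᵢ = αᵢ + i − 1.
diag : ℕ → List ℕ → List ℕ
diag o []      = []
diag o (x ∷ α) = o + x ∷ diag (suc o) α

undiag : ℕ → List ℕ → List ℕ
undiag o []       = []
undiag o (y ∷ ys) = y ∸ o ∷ undiag (suc o) ys

SlowlyRising : List ℕ → Set
SlowlyRising = Linked (λ x y → y ≤ suc x)

δʳ≡count≥-diag : ∀ α o k → length α ≤ k → δʳ α k ≡ count≥ (o + k) (diag o α)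
δʳ≡count≥-diag []      o k       _         = refl
δʳ≡count≥-diag (x ∷ α) o (suc k) (s≤s α≤k) rewrite +-suc o k =
  cong₂ _+_ (cong χ (sym (<ᵇ-cancelˡ o k x))) (δʳ≡count≥-diag α (suc o) k α≤k)

δʳ-saturated : ∀ α o k → k ≤ length α → All (o + k ≤_) (diag o α) → δʳ α k ≡ k
δʳ-saturated α       o zero    _         _        = δʳ-zero α
δʳ-saturated (x ∷ α) o (suc k) (s≤s k≤α) (p ∷ ps) =
  cong₂ _+_ (<⇒χ<ᵇ≡1 (+-cancelˡ-≤ o (suc k) x p))
    (δʳ-saturated α (suc o) k k≤α (All.map (≤-trans (≤-reflexive (sym (+-suc o k)))) ps))

count≥≤length : ∀ k ys → count≥ k ys ≤ length ys
count≥≤length k []       = z≤n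
count≥≤length k (y ∷ ys) = +-mono-≤ (χ≤1 (k <ᵇ suc y)) (count≥≤length k ys)

count≥-zero : ∀ ys → count≥ 0 ys ≡ length ys
count≥-zero []       = refl
count≥-zero (y ∷ ys) = cong suc (count≥-zero ys)

count≥≡length⇒All : ∀ k ys → count≥ k ys ≡ length ys → All (k ≤_) ys
count≥≡length⇒All k []       _ = []
count≥≡length⇒All k (y ∷ ys) h with k ≤? y
... | yes k≤y =
  k≤y ∷ count≥≡length⇒All k ys (suc-injective (trans (cong (_+ count≥ k ys) (sym (<⇒χ<ᵇ≡1 (s≤s k≤y)))) h))
... | no  k≰y = contradiction (trans (sym (cong (_+ count≥ k ys) (≤⇒χ<ᵇ≡0 (≰⇒> k≰y)))) h)
                  (<⇒≢ (s≤s (count≥≤length k ys)))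

count≥-map-+ : ∀ q j γ → count≥ (q + j) (map (q +_) γ) ≡ count≥ j γ
count≥-map-+ q j []      = refl
count≥-map-+ q j (y ∷ γ) =
  cong₂ _+_ (cong χ (trans (cong (q + j <ᵇ_) (sym (+-suc q y))) (<ᵇ-cancelˡ q j (suc y)))) (count≥-map-+ q j γ)

length-diag : ∀ o α → length (diag o α) ≡ length α
length-diag o []      = refl
length-diag o (x ∷ α) = cong suc (length-diag (suc o) α)

length-undiag : ∀ o ys → length (undiag o ys) ≡ length ys
length-undiag o []       = refl
length-undiag o (y ∷ ys) = cong suc (length-undiag (suc o) ys)

undiag-diag : ∀ o α → undiag o (diag o α) ≡ α
undiag-diag o []      = refl
undiag-diag o (x ∷ α) = cong₂ _∷_ (m+n∸m≡n o x) (undiag-diag (suc o) α)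

diag-undiag : ∀ o ys → All (o + length ys ≤_) ys → diag o (undiag o ys) ≡ ys
diag-undiag o []       _        = refl
diag-undiag o (y ∷ ys) (p ∷ ps) =
  cong₂ _∷_ (m+[n∸m]≡n (≤-trans (m≤m+n o _) p))
    (diag-undiag (suc o) ys (All.map (≤-trans (≤-reflexive (sym (+-suc o (length ys))))) ps))

undiag-positive : ∀ o ys → All (o + length ys ≤_) ys → All (1 ≤_) (undiag o ys)
undiag-positive o []       _        = []
undiag-positive o (y ∷ ys) (p ∷ ps) =
  m<n⇒0<n∸m (≤-trans (≤-reflexive (+-comm 1 o)) (≤-trans (+-monoʳ-≤ o (s≤s z≤n)) p))
  ∷ undiag-positive (suc o) ys (All.map (≤-trans (≤-reflexive (sym (+-suc o (length ys))))) ps)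

diag-slowlyRising : ∀ o {α} → Linked _≥_ α → SlowlyRising (diag o α)
diag-slowlyRising o []          = []
diag-slowlyRising o [-]         = [-]
diag-slowlyRising o (y≤x ∷ lin) = s≤s (+-monoʳ-≤ o y≤x) ∷ diag-slowlyRising (suc o) lin

undiag-linked : ∀ o {ys} → SlowlyRising ys → Linked _≥_ (undiag o ys)
undiag-linked o []      = []
undiag-linked o [-]     = [-]
undiag-linked o (p ∷ r) = ∸-monoˡ-≤ (suc o) p ∷ undiag-linked (suc o) r

slowlyRising-map-+ : ∀ q {w} → SlowlyRising w → SlowlyRising (map (q +_) w)
slowlyRising-map-+ q r = Linked.map⁺ (Linked.map (λ {x} p → ≤-trans (+-monoʳ-≤ q p) (≤-reflexive (+-suc q x))) r)

slowlyRising-map-∸ : ∀ q {w} → SlowlyRising w → SlowlyRising (map (_∸ q) w)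
slowlyRising-map-∸ q r = Linked.map⁺ (Linked.map (λ {x} p → ≤-trans (∸-monoˡ-≤ q p) (suc-∸-≤ x q)) r)
  where
  suc-∸-≤ : ∀ m n → suc m ∸ n ≤ suc (m ∸ n)
  suc-∸-≤ m       zero    = ≤-refl
  suc-∸-≤ zero    (suc n) = ≤-trans (≤-reflexive (0∸n≡0 n)) z≤n
  suc-∸-≤ (suc m) (suc n) = suc-∸-≤ m n

-- The lowest level of a word

#zeros : List ℕ → ℕ
#zeros []          = 0
#zeros (zero  ∷ w) = suc (#zeros w)
#zeros (suc _ ∷ w) = #zeros w

#false : List Bool → ℕ
#false []          = 0
#false (false ∷ v) = suc (#false v)
#false (true  ∷ v) = #false v

#true : List Bool → ℕ
#true []          = 0
#true (false ∷ v) = #true v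
#true (true  ∷ v) = suc (#true v)

lower : List ℕ → List ℕ
lower []          = []
lower (zero  ∷ w) = lower w
lower (suc x ∷ w) = x ∷ lower w

pattern01 : List ℕ → List Bool
pattern01 []                = []
pattern01 (zero        ∷ w) = false ∷ pattern01 w
pattern01 (suc zero    ∷ w) = true  ∷ pattern01 w
pattern01 (suc (suc _) ∷ w) = pattern01 w

-- Inverse of w ↦ (lower w , pattern01 w): raise w by one and insert, for each false in v, a 0
-- in front of the next 1 (or at the end); a true marks that 1.
unlower : List ℕ → List Bool → List ℕ
unlower []          v           = replicate (length v) 0
unlower (suc x ∷ w) v           = suc (suc x) ∷ unlower w v
unlower (zero  ∷ w) (false ∷ v) = 0 ∷ unlower (zero ∷ w) v
unlower (zero  ∷ w) (true  ∷ v) = 1 ∷ unlower w v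
unlower (zero  ∷ w) []          = 1 ∷ unlower w []

lower-replicate : ∀ n → lower (replicate n 0) ≡ []
lower-replicate zero    = refl
lower-replicate (suc n) = lower-replicate n

lower-unlower : ∀ w v → lower (unlower w v) ≡ w
lower-unlower []          v           = lower-replicate (length v)
lower-unlower (suc x ∷ w) v           = cong (suc x ∷_) (lower-unlower w v)
lower-unlower (zero  ∷ w) (false ∷ v) = lower-unlower (zero ∷ w) v
lower-unlower (zero  ∷ w) (true  ∷ v) = cong (0 ∷_) (lower-unlower w v)
lower-unlower (zero  ∷ w) []          = cong (0 ∷_) (lower-unlower w [])

pattern01-unlower : ∀ w v → #true v ≡ #zeros w → pattern01 (unlower w v) ≡ v
pattern01-unlower []          []          _  = refl
pattern01-unlower []          (false ∷ v) h  = cong (false ∷_) (pattern01-unlower [] v h)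
pattern01-unlower (suc x ∷ w) v           h  = pattern01-unlower w v h
pattern01-unlower (zero  ∷ w) (false ∷ v) h  = cong (false ∷_) (pattern01-unlower (zero ∷ w) v h)
pattern01-unlower (zero  ∷ w) (true  ∷ v) h  = cong (true ∷_) (pattern01-unlower w v (suc-injective h))

unlower-false : ∀ w → SlowlyRising (0 ∷ w) → ∀ v → unlower (lower w) (false ∷ v) ≡ 0 ∷ unlower (lower w) v
unlower-false []                _                   v = refl
unlower-false (zero ∷ w)        (_ ∷ r)             v = unlower-false w r v
unlower-false (suc zero ∷ w)    _                   v = refl
unlower-false (suc (suc x) ∷ w) (s≤s () ∷ _)        v

unlower-lower : ∀ w → SlowlyRising w → unlower (lower w) (pattern01 w) ≡ w
unlower-lower []                _ = refl
unlower-lower (zero ∷ w)        r = trans (unlower-false w r (pattern01 w)) (cong (0 ∷_) (unlower-lower w (Linked.tail r)))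
unlower-lower (suc zero ∷ w)    r = cong (1 ∷_) (unlower-lower w (Linked.tail r))
unlower-lower (suc (suc x) ∷ w) r = cong (suc (suc x) ∷_) (unlower-lower w (Linked.tail r))

slowlyRising-replicate-0 : ∀ c n → SlowlyRising (c ∷ replicate n 0)
slowlyRising-replicate-0 c zero    = [-]
slowlyRising-replicate-0 c (suc n) = z≤n ∷ slowlyRising-replicate-0 0 n

unlower-slowlyRising′ : ∀ c w v → SlowlyRising (c ∷ map suc w) → SlowlyRising (c ∷ unlower w v)
unlower-slowlyRising′ c []          v           _       = slowlyRising-replicate-0 c (length v)
unlower-slowlyRising′ c (suc x ∷ w) v           (p ∷ r) = p ∷ unlower-slowlyRising′ (suc (suc x)) w v r
unlower-slowlyRising′ c (zero  ∷ w) (false ∷ v) (_ ∷ r) = z≤n ∷ unlower-slowlyRising′ 0 (zero ∷ w) v (s≤s z≤n ∷ r)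
unlower-slowlyRising′ c (zero  ∷ w) (true  ∷ v) (_ ∷ r) = s≤s z≤n ∷ unlower-slowlyRising′ 1 w v r
unlower-slowlyRising′ c (zero  ∷ w) []          (_ ∷ r) = s≤s z≤n ∷ unlower-slowlyRising′ 1 w [] r

unlower-slowlyRising : ∀ w v → SlowlyRising w → SlowlyRising (unlower w v)
unlower-slowlyRising []      v _ = Linked.tail (unlower-slowlyRising′ 0 [] v [-])
unlower-slowlyRising (x ∷ w) v r = Linked.tail (unlower-slowlyRising′ x (x ∷ w) v (≤-refl ∷ slowlyRising-map-+ 1 r))

mutual
  lower-slowlyRising′ : ∀ c w → SlowlyRising (suc c ∷ w) → SlowlyRising (c ∷ lower w)
  lower-slowlyRising′ c []          _             = [-]
  lower-slowlyRising′ c (zero  ∷ w) (_ ∷ r)       = lower-slowlyRising-after-0 w r c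
  lower-slowlyRising′ c (suc y ∷ w) (s≤s p ∷ r)   = p ∷ lower-slowlyRising′ y w r

  lower-slowlyRising-after-0 : ∀ w → SlowlyRising (0 ∷ w) → ∀ c → SlowlyRising (c ∷ lower w)
  lower-slowlyRising-after-0 []                _            c = [-]
  lower-slowlyRising-after-0 (zero ∷ w)        (_ ∷ r)      c = lower-slowlyRising-after-0 w r c
  lower-slowlyRising-after-0 (suc zero ∷ w)    (_ ∷ r)      c = z≤n ∷ lower-slowlyRising′ 0 w r
  lower-slowlyRising-after-0 (suc (suc x) ∷ w) (s≤s () ∷ _) c

lower-slowlyRising : ∀ w → SlowlyRising w → SlowlyRising (lower w)
lower-slowlyRising []      _ = []
lower-slowlyRising (x ∷ w) r = Linked.tail (lower-slowlyRising′ x (x ∷ w) (m≤n⇒m≤1+n (n≤1+n x) ∷ r))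

count≥-replicate-0 : ∀ j n → count≥ (suc j) (replicate n 0) ≡ 0
count≥-replicate-0 j zero    = refl
count≥-replicate-0 j (suc n) = count≥-replicate-0 j n

count≥-unlower : ∀ j w v → count≥ (suc j) (unlower w v) ≡ count≥ j w
count≥-unlower j []          v           = count≥-replicate-0 j (length v)
count≥-unlower j (suc x ∷ w) v           = cong (χ (j <ᵇ suc (suc x)) +_) (count≥-unlower j w v)
count≥-unlower j (zero  ∷ w) (false ∷ v) = count≥-unlower j (zero ∷ w) v
count≥-unlower j (zero  ∷ w) (true  ∷ v) = cong (χ (j <ᵇ 1) +_) (count≥-unlower j w v)
count≥-unlower j (zero  ∷ w) []          = cong (χ (j <ᵇ 1) +_) (count≥-unlower j w [])

count≥-lower : ∀ j w → count≥ j (lower w) ≡ count≥ (suc j) w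
count≥-lower j []          = refl
count≥-lower j (zero  ∷ w) = count≥-lower j w
count≥-lower j (suc x ∷ w) = cong (χ (j <ᵇ suc x) +_) (count≥-lower j w)

#zeros≡count≥-0∸count≥-1 : ∀ w → #zeros w ≡ count≥ 0 w ∸ count≥ 1 w
#zeros≡count≥-0∸count≥-1 w = sym (trans (cong (_∸ count≥ 1 w) (split w)) (m+n∸n≡m (#zeros w) (count≥ 1 w)))
  where
  split : ∀ w → count≥ 0 w ≡ #zeros w + count≥ 1 w
  split []          = refl
  split (zero  ∷ w) = cong suc (split w)
  split (suc x ∷ w) = trans (cong suc (split w)) (sym (+-suc (#zeros w) (count≥ 1 w)))

length-unlower : ∀ w v → #true v ≡ #zeros w → length (unlower w v) ≡ #false v + length w
length-unlower []          []          _ = refl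
length-unlower []          (false ∷ v) h = cong suc (length-unlower [] v h)
length-unlower (suc x ∷ w) v           h = trans (cong suc (length-unlower w v h)) (sym (+-suc (#false v) (length w)))
length-unlower (zero  ∷ w) (false ∷ v) h = cong suc (length-unlower (zero ∷ w) v h)
length-unlower (zero  ∷ w) (true  ∷ v) h =
  trans (cong suc (length-unlower w v (suc-injective h))) (sym (+-suc (#false v) (length w)))

#false-pattern01 : ∀ w → #false (pattern01 w) ≡ #zeros w
#false-pattern01 []                = refl
#false-pattern01 (zero ∷ w)        = cong suc (#false-pattern01 w)
#false-pattern01 (suc zero ∷ w)    = #false-pattern01 w
#false-pattern01 (suc (suc x) ∷ w) = #false-pattern01 w

#true-pattern01 : ∀ w → #true (pattern01 w) ≡ #zeros (lower w)
#true-pattern01 []                = refl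
#true-pattern01 (zero ∷ w)        = #true-pattern01 w
#true-pattern01 (suc zero ∷ w)    = cong suc (#true-pattern01 w)
#true-pattern01 (suc (suc x) ∷ w) = #true-pattern01 w

-- Shuffles

shuffles : ℕ → ℕ → List (List Bool)
shuffles zero    zero    = [] ∷ []
shuffles zero    (suc b) = map (true ∷_) (shuffles zero b)
shuffles (suc a) zero    = map (false ∷_) (shuffles a zero)
shuffles (suc a) (suc b) = map (false ∷_) (shuffles a (suc b)) ++ map (true ∷_) (shuffles (suc a) b)

∈-shuffles⁻ : ∀ a b {v} → v ∈ shuffles a b → #false v ≡ a × #true v ≡ b
∈-shuffles⁻ zero    zero    (here refl) = refl , refl
∈-shuffles⁻ zero    (suc b) v∈ with ∈-map⁻ (true ∷_) v∈
... | _ , v′∈ , refl = map₂ (cong suc) (∈-shuffles⁻ zero b v′∈)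
∈-shuffles⁻ (suc a) zero    v∈ with ∈-map⁻ (false ∷_) v∈
... | _ , v′∈ , refl = map₁ (cong suc) (∈-shuffles⁻ a zero v′∈)
∈-shuffles⁻ (suc a) (suc b) v∈ with ∈-++⁻ (map (false ∷_) (shuffles a (suc b))) v∈
... | inj₁ v∈ˡ with ∈-map⁻ (false ∷_) v∈ˡ
...   | _ , v′∈ , refl = map₁ (cong suc) (∈-shuffles⁻ a (suc b) v′∈)
∈-shuffles⁻ (suc a) (suc b) v∈ | inj₂ v∈ʳ with ∈-map⁻ (true ∷_) v∈ʳ
...   | _ , v′∈ , refl = map₂ (cong suc) (∈-shuffles⁻ (suc a) b v′∈)

∈-shuffles⁺ : ∀ v → v ∈ shuffles (#false v) (#true v)
∈-shuffles⁺ []          = here refl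
∈-shuffles⁺ (false ∷ v) with #true v | ∈-shuffles⁺ v
... | zero  | v∈ = ∈-map⁺ (false ∷_) v∈
... | suc b | v∈ = ∈-++⁺ˡ (∈-map⁺ (false ∷_) v∈)
∈-shuffles⁺ (true ∷ v) with #false v | ∈-shuffles⁺ v
... | zero  | v∈ = ∈-map⁺ (true ∷_) v∈
... | suc a | v∈ = ∈-++⁺ʳ (map (false ∷_) (shuffles a (suc (#true v)))) (∈-map⁺ (true ∷_) v∈)

shuffles-unique : ∀ a b → Unique (shuffles a b)
shuffles-unique zero    zero    = [] ∷ []
shuffles-unique zero    (suc b) = Unique.map⁺ ∷-injectiveʳ (shuffles-unique zero b)
shuffles-unique (suc a) zero    = Unique.map⁺ ∷-injectiveʳ (shuffles-unique a zero)
shuffles-unique (suc a) (suc b) =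
  Unique.++⁺ (Unique.map⁺ ∷-injectiveʳ (shuffles-unique a (suc b)))
             (Unique.map⁺ ∷-injectiveʳ (shuffles-unique (suc a) b))
             disjoint
  where
  disjoint : ∀ {v} → v ∈ map (false ∷_) (shuffles a (suc b)) × v ∈ map (true ∷_) (shuffles (suc a) b) → ⊥
  disjoint (v∈ˡ , v∈ʳ) with ∈-map⁻ (false ∷_) v∈ˡ | ∈-map⁻ (true ∷_) v∈ʳ
  ... | _ , _ , refl | _ , _ , ()

length-shuffles : ∀ a b → length (shuffles a b) ≡ (a + b) C a
length-shuffles zero    zero    = refl
length-shuffles zero    (suc b) = trans (length-map _ (shuffles zero b)) (length-shuffles zero b)
length-shuffles (suc a) zero    = begin
  length (map (false ∷_) (shuffles a zero)) ≡⟨ length-map _ (shuffles a zero) ⟩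
  length (shuffles a zero)                  ≡⟨ length-shuffles a zero ⟩
  (a + 0) C a                               ≡⟨ cong (_C a) (+-identityʳ a) ⟩
  a C a                                     ≡⟨ trans (nCn≡1 a) (sym (nCn≡1 (suc a))) ⟩
  suc a C suc a                             ≡⟨ cong (_C suc a) (sym (+-identityʳ (suc a))) ⟩
  (suc a + 0) C suc a                       ∎
  where open ≡-Reasoning
length-shuffles (suc a) (suc b) = begin
  length (map (false ∷_) (shuffles a (suc b)) ++ map (true ∷_) (shuffles (suc a) b))
    ≡⟨ length-++ (map (false ∷_) (shuffles a (suc b))) ⟩
  length (map (false ∷_) (shuffles a (suc b))) + length (map (true ∷_) (shuffles (suc a) b))
    ≡⟨ cong₂ _+_ (trans (length-map _ (shuffles a (suc b))) (length-shuffles a (suc b)))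
                 (trans (length-map _ (shuffles (suc a) b)) (length-shuffles (suc a) b)) ⟩
  (a + suc b) C a + suc (a + b) C suc a
    ≡⟨ cong (λ n → (a + suc b) C a + n C suc a) (sym (+-suc a b)) ⟩
  (a + suc b) C a + (a + suc b) C suc a
    ≡⟨ nCk+nC[k+1]≡[n+1]C[k+1] (a + suc b) a ⟩
  suc (a + suc b) C suc a ∎
  where open ≡-Reasoning

-- Words with a prescribed profile

HasProfile : (ℕ → ℕ) → List ℕ → Set
HasProfile t w = ∀ j → count≥ j w ≡ t j

Admissible : ℕ → (ℕ → ℕ) → Set
Admissible m t = (∀ j → t (suc j) ≤ t j) × (∀ j → m < j → t j ≡ 0)

shift : (ℕ → ℕ) → ℕ → ℕ
shift t j = t (suc j)

admissible-shift : ∀ {m t} → Admissible (suc m) t → Admissible m (shift t)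
admissible-shift (t↓ , t≡0) = (λ j → t↓ (suc j)) , (λ j m<j → t≡0 (suc j) (s≤s m<j))

descent : (ℕ → ℕ) → ℕ → ℕ
descent t j = t j ∸ t (suc j)

descentBinomial : (ℕ → ℕ) → ℕ → ℕ
descentBinomial t j = (descent t j + descent t (suc j)) C descent t j

profileWords : ℕ → (ℕ → ℕ) → List (List ℕ)
profileWords zero    t = replicate (t 0) 0 ∷ []
profileWords (suc m) t =
  map (uncurry unlower) (cartesianProduct (profileWords m (shift t)) (shuffles (descent t 0) (descent t 1)))

#true≡#zeros : ∀ t a v → HasProfile (shift t) a → #true v ≡ descent t 1 → #true v ≡ #zeros a
#true≡#zeros t a v a-prof v-true =
  trans v-true (sym (trans (#zeros≡count≥-0∸count≥-1 a) (cong₂ _∸_ (a-prof 0) (a-prof 1))))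

∈-profileWords⁻ : ∀ m t → Admissible m t → ∀ {w} → w ∈ profileWords m t → SlowlyRising w × HasProfile t w
∈-profileWords⁻ zero    t (_ , t≡0) (here refl) = Linked.tail (slowlyRising-replicate-0 0 (t 0)) , profile
  where
  profile : HasProfile t (replicate (t 0) 0)
  profile zero    = trans (count≥-zero (replicate (t 0) 0)) (length-replicate (t 0))
  profile (suc j) = trans (count≥-replicate-0 j (t 0)) (sym (t≡0 (suc j) (s≤s z≤n)))
∈-profileWords⁻ (suc m) t adm w∈ with ∈-map⁻ (uncurry unlower) w∈
... | (a , v) , av∈ , refl with ∈-cartesianProduct⁻ (profileWords m (shift t)) _ av∈
... | a∈ , v∈ with ∈-profileWords⁻ m (shift t) (admissible-shift adm) a∈ | ∈-shuffles⁻ (descent t 0) (descent t 1) v∈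
... | a-rising , a-prof | v-false , v-true = unlower-slowlyRising a v a-rising , profile
  where
  profile : HasProfile t (unlower a v)
  profile zero    = begin
    count≥ 0 (unlower a v)  ≡⟨ count≥-zero (unlower a v) ⟩
    length (unlower a v)    ≡⟨ length-unlower a v (#true≡#zeros t a v a-prof v-true) ⟩
    #false v + length a     ≡⟨ cong₂ _+_ v-false (trans (sym (count≥-zero a)) (a-prof 0)) ⟩
    descent t 0 + t 1       ≡⟨ m∸n+n≡m (proj₁ adm 0) ⟩
    t 0                     ∎
    where open ≡-Reasoning
  profile (suc j) = trans (count≥-unlower j a v) (a-prof j)

∈-profileWords⁺ : ∀ m t → Admissible m t → ∀ {w} → SlowlyRising w → HasProfile t w → w ∈ profileWords m t
∈-profileWords⁺ zero    t (_ , t≡0) {w} _ prof = here (trans (all-zero w (trans (prof 1) (t≡0 1 (s≤s z≤n))))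
  (cong (λ n → replicate n 0) (trans (sym (count≥-zero w)) (prof 0))))
  where
  all-zero : ∀ w → count≥ 1 w ≡ 0 → w ≡ replicate (length w) 0
  all-zero []          _ = refl
  all-zero (zero ∷ w)  h = cong (0 ∷_) (all-zero w h)
∈-profileWords⁺ (suc m) t adm {w} rising prof =
  subst (_∈ profileWords (suc m) t) (unlower-lower w rising)
    (∈-map⁺ (uncurry unlower) (∈-cartesianProduct⁺ lower∈ pattern∈))
  where
  lower∈ : lower w ∈ profileWords m (shift t)
  lower∈ = ∈-profileWords⁺ m (shift t) (admissible-shift adm) (lower-slowlyRising w rising)
             (λ j → trans (count≥-lower j w) (prof (suc j)))
  pattern∈ : pattern01 w ∈ shuffles (descent t 0) (descent t 1)
  pattern∈ = subst₂ (λ a b → pattern01 w ∈ shuffles a b)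
    (trans (#false-pattern01 w) (trans (#zeros≡count≥-0∸count≥-1 w) (cong₂ _∸_ (prof 0) (prof 1))))
    (trans (#true-pattern01 w) (trans (#zeros≡count≥-0∸count≥-1 (lower w))
      (cong₂ _∸_ (trans (count≥-lower 0 w) (prof 1)) (trans (count≥-lower 1 w) (prof 2)))))
    (∈-shuffles⁺ (pattern01 w))

profileWords-unique : ∀ m t → Admissible m t → Unique (profileWords m t)
profileWords-unique zero    t _   = [] ∷ []
profileWords-unique (suc m) t adm =
  Unique-map⁺-onInverse (uncurry unlower) (λ w → lower w , pattern01 w)
    (Unique.cartesianProduct⁺ (profileWords-unique m (shift t) (admissible-shift adm))
                              (shuffles-unique (descent t 0) (descent t 1)))
    inverse
  where
  inverse : ∀ {p} → p ∈ cartesianProduct (profileWords m (shift t)) (shuffles (descent t 0) (descent t 1)) →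
            (lower (uncurry unlower p) , pattern01 (uncurry unlower p)) ≡ p
  inverse {a , v} av∈ with ∈-cartesianProduct⁻ (profileWords m (shift t)) _ av∈
  ... | a∈ , v∈ = cong₂ _,_ (lower-unlower a v)
    (pattern01-unlower a v (#true≡#zeros t a v (proj₂ (∈-profileWords⁻ m (shift t) (admissible-shift adm) a∈))
                                                (proj₂ (∈-shuffles⁻ (descent t 0) (descent t 1) v∈))))

length-profileWords : ∀ m t → length (profileWords m t) ≡ product (applyUpTo (descentBinomial t) m)
length-profileWords zero    t = refl
length-profileWords (suc m) t = begin
  length (map (uncurry unlower) (cartesianProduct (profileWords m (shift t)) (shuffles (descent t 0) (descent t 1))))
    ≡⟨ length-map (uncurry unlower) (cartesianProduct (profileWords m (shift t)) (shuffles (descent t 0) (descent t 1))) ⟩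
  length (cartesianProduct (profileWords m (shift t)) (shuffles (descent t 0) (descent t 1)))
    ≡⟨ length-cartesianProduct (profileWords m (shift t)) _ ⟩
  length (profileWords m (shift t)) * length (shuffles (descent t 0) (descent t 1))
    ≡⟨ cong₂ _*_ (length-profileWords m (shift t)) (length-shuffles (descent t 0) (descent t 1)) ⟩
  product (applyUpTo (descentBinomial (shift t)) m) * descentBinomial t 0
    ≡⟨ *-comm (product (applyUpTo (descentBinomial (shift t)) m)) (descentBinomial t 0) ⟩
  product (applyUpTo (descentBinomial t) (suc m)) ∎
  where open ≡-Reasoning

-- Counting [ d ]_q

module DiagonalWords (d : ℕ → ℕ) (q : ℕ) (q≥1 : 1 ≤ q) (d-init : ∀ i → 1 ≤ i → i ≤ q → d i ≡ i) where

  t : ℕ → ℕ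
  t j = d (q + j)

  fromWord : List ℕ → List ℕ
  fromWord γ = undiag 0 (map (q +_) γ)

  toWord : List ℕ → List ℕ
  toWord α = map (_∸ q) (diag 0 α)

  dq≡q : d q ≡ q
  dq≡q = d-init q q≥1 ≤-refl

  module _ (γ : List ℕ) (γ-prof : HasProfile t γ) where

    private
      length-word : length γ ≡ q
      length-word = trans (sym (count≥-zero γ)) (trans (γ-prof 0) (trans (cong d (+-identityʳ q)) dq≡q))

      β : List ℕ
      β = map (q +_) γ

      length-β : length β ≡ q
      length-β = trans (length-map (q +_) γ) length-word

      β-bound : All (0 + length β ≤_) β
      β-bound = subst (λ l → All (l ≤_) β) (sym length-β) (All-≤-map-+ q γ)

    diag-fromWord : diag 0 (fromWord γ) ≡ map (q +_) γ
    diag-fromWord = diag-undiag 0 β β-bound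

    toWord-fromWord : toWord (fromWord γ) ≡ γ
    toWord-fromWord = trans (cong (map (_∸ q)) diag-fromWord) (map-∸-map-+ q γ)

    length-fromWord : length (fromWord γ) ≡ q
    length-fromWord = trans (length-undiag 0 β) length-β

    fromWord-positive : All (1 ≤_) (fromWord γ)
    fromWord-positive = undiag-positive 0 β β-bound

    δ-fromWord : δ (fromWord γ) ≈ₛ d
    δ-fromWord k k≥1 with k ≤? q
    ... | yes k≤q = begin
      δ (fromWord γ) k  ≡⟨ δ≗δʳ (fromWord γ) k ⟩
      δʳ (fromWord γ) k ≡⟨ δʳ-saturated (fromWord γ) 0 k (≤-trans k≤q (≤-reflexive (sym length-fromWord)))
                             (subst (All (k ≤_)) (sym diag-fromWord) (All.map (≤-trans k≤q) (All-≤-map-+ q γ))) ⟩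
      k                 ≡⟨ sym (d-init k k≥1 k≤q) ⟩
      d k               ∎
      where open ≡-Reasoning
    ... | no k≰q = begin
      δ (fromWord γ) k                ≡⟨ δ≗δʳ (fromWord γ) k ⟩
      δʳ (fromWord γ) k               ≡⟨ δʳ≡count≥-diag (fromWord γ) 0 k (≤-trans (≤-reflexive length-fromWord) q≤k) ⟩
      count≥ k (diag 0 (fromWord γ))  ≡⟨ cong₂ count≥ (sym q+[k∸q]≡k) diag-fromWord ⟩
      count≥ (q + (k ∸ q)) β          ≡⟨ count≥-map-+ q (k ∸ q) γ ⟩
      count≥ (k ∸ q) γ                ≡⟨ γ-prof (k ∸ q) ⟩
      d (q + (k ∸ q))                 ≡⟨ cong d q+[k∸q]≡k ⟩
      d k                             ∎
      where
      open ≡-Reasoning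
      q≤k : q ≤ k
      q≤k = <⇒≤ (≰⇒> k≰q)
      q+[k∸q]≡k : q + (k ∸ q) ≡ k
      q+[k∸q]≡k = m+[n∸m]≡n q≤k

  module _ (α : List ℕ) (α-linked : Linked _≥_ α) (length-α : length α ≡ q) (δα≈d : δ α ≈ₛ d) where

    private
      β : List ℕ
      β = diag 0 α

      β-bound : All (q ≤_) β
      β-bound = count≥≡length⇒All q β (begin
        count≥ q β   ≡⟨ sym (δʳ≡count≥-diag α 0 q (≤-reflexive length-α)) ⟩
        δʳ α q       ≡⟨ ≈ₛ-δʳ α δα≈d q q≥1 ⟩
        d q          ≡⟨ dq≡q ⟩
        q            ≡⟨ sym (trans (length-diag 0 α) length-α) ⟩
        length β     ∎)
        where open ≡-Reasoning

      map-+-toWord : map (q +_) (toWord α) ≡ β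
      map-+-toWord = map-+-map-∸ q β β-bound

    fromWord-toWord : fromWord (toWord α) ≡ α
    fromWord-toWord = trans (cong (undiag 0) map-+-toWord) (undiag-diag 0 α)

    toWord-slowlyRising : SlowlyRising (toWord α)
    toWord-slowlyRising = slowlyRising-map-∸ q (diag-slowlyRising 0 α-linked)

    toWord-profile : HasProfile t (toWord α)
    toWord-profile j = begin
      count≥ j (toWord α)                      ≡⟨ sym (count≥-map-+ q j (toWord α)) ⟩
      count≥ (q + j) (map (q +_) (toWord α))   ≡⟨ cong (count≥ (q + j)) map-+-toWord ⟩
      count≥ (q + j) β                         ≡⟨ sym (δʳ≡count≥-diag α 0 (q + j) (≤-trans (≤-reflexive length-α) (m≤m+n q j))) ⟩
      δʳ α (q + j)                             ≡⟨ ≈ₛ-δʳ α δα≈d (q + j) (≤-trans q≥1 (m≤m+n q j)) ⟩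
      d (q + j)                                ∎
      where open ≡-Reasoning

bseq≡descent : ∀ d L → (∀ k → L < k → d k ≡ 0) → ∀ {i} → i ≤ L → bseq d L i ≡ d i ∸ d (suc i)
bseq≡descent d L d≡0 {i} i≤L with i <ᵇ L in i<ᵇL | m≤n⇒m<n∨m≡n i≤L
... | true  | _         = refl
... | false | inj₁ i<L  = ⊥-elim (subst T i<ᵇL (<⇒<ᵇ i<L))
... | false | inj₂ refl = sym (cong (d i ∸_) (d≡0 (suc i) ≤-refl))

module Count (n : ℕ) (d : ℕ → ℕ) (α′ : List ℕ) (α′-partition : IsPartition n α′) (δα′≈d : δ α′ ≈ₛ d)
             (L : ℕ) (d≡0 : ∀ k → L < k → d k ≡ 0)
             (q : ℕ) (q≥1 : 1 ≤ q) (d-init : ∀ i → 1 ≤ i → i ≤ q → d i ≡ i) (d[1+q]≤q : d (suc q) ≤ q) where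

  open DiagonalWords d q q≥1 d-init

  q≤L : q ≤ L
  q≤L with q ≤? L
  ... | yes q≤L = q≤L
  ... | no  q≰L = contradiction (trans (sym dq≡q) (d≡0 q (≰⇒> q≰L))) (m<n⇒n≢0 q≥1)

  admissible : Admissible (L ∸ q) t
  admissible = t-antitone , t-vanishes
    where
    t-antitone : ∀ j → t (suc j) ≤ t j
    t-antitone j = begin
      t (suc j)             ≡⟨ cong d (+-suc q j) ⟩
      d (suc (q + j))       ≡⟨ sym (≈ₛ-δʳ α′ δα′≈d (suc (q + j)) (s≤s z≤n)) ⟩
      δʳ α′ (suc (q + j))   ≤⟨ δʳ-antitone (proj₁ α′-partition) δʳα′[1+q]≤q (m≤m+n q j) ⟩
      δʳ α′ (q + j)         ≡⟨ ≈ₛ-δʳ α′ δα′≈d (q + j) (≤-trans q≥1 (m≤m+n q j)) ⟩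
      t j                   ∎
      where
      open ≤-Reasoning
      δʳα′[1+q]≤q : δʳ α′ (suc q) ≤ q
      δʳα′[1+q]≤q = ≤-trans (≤-reflexive (≈ₛ-δʳ α′ δα′≈d (suc q) (s≤s z≤n))) d[1+q]≤q
    t-vanishes : ∀ j → L ∸ q < j → t j ≡ 0
    t-vanishes j L∸q<j =
      d≡0 (q + j) (≤-trans (≤-reflexive (cong suc (sym (m+[n∸m]≡n q≤L)))) (+-monoʳ-< q L∸q<j))

  InClass : List ℕ → Set
  InClass α = IsPartition n α × numParts α ≡ q × δ α ≈ₛ d

  classList : List (List ℕ)
  classList = map fromWord (profileWords (L ∸ q) t)

  classList-unique : Unique classList
  classList-unique = Unique-map⁺-onInverse fromWord toWord (profileWords-unique (L ∸ q) t admissible)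
    (λ γ∈ → toWord-fromWord _ (proj₂ (∈-profileWords⁻ (L ∸ q) t admissible γ∈)))

  ∈-classList : ∀ α → α ∈ classList ⇔ InClass α
  ∈-classList α = mk⇔ sound complete
    where
    sound : α ∈ classList → InClass α
    sound α∈ with ∈-map⁻ fromWord α∈
    ... | γ , γ∈ , refl with ∈-profileWords⁻ (L ∸ q) t admissible γ∈
    ... | γ-rising , γ-prof =
      ( undiag-linked 0 (slowlyRising-map-+ q γ-rising)
      , fromWord-positive γ γ-prof
      , trans (δ-≈ₛ⇒sum-≡ (fromWord γ) α′ (λ k k≥1 → trans (δ-fromWord γ γ-prof k k≥1) (sym (δα′≈d k k≥1))))
              (proj₂ (proj₂ α′-partition)))
      , length-fromWord γ γ-prof
      , δ-fromWord γ γ-prof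
    complete : InClass α → α ∈ classList
    complete ((α-linked , _ , _) , length-α , δα≈d) =
      subst (_∈ classList) (fromWord-toWord α α-linked length-α δα≈d)
        (∈-map⁺ fromWord (∈-profileWords⁺ (L ∸ q) t admissible
          (toWord-slowlyRising α α-linked length-α δα≈d) (toWord-profile α α-linked length-α δα≈d)))

  length-classList : length classList ≡ prodRange q L (λ i → (bseq d L i + bseq d L (suc i)) C bseq d L i)
  length-classList = trans (length-map fromWord (profileWords (L ∸ q) t))
    (trans (length-profileWords (L ∸ q) t) (cong product (applyUpTo-cong _ _ (L ∸ q) factor)))
    where
    factor : ∀ {j} → j < L ∸ q → descentBinomial t j ≡ (bseq d L (q + j) + bseq d L (suc (q + j))) C bseq d L (q + j)
    factor {j} j<L∸q = cong₂ (λ a b → (a + b) C a) (descent≡bseq j (<⇒≤ q+j<L))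
      (trans (descent≡bseq (suc j) (≤-trans (≤-reflexive (+-suc q j)) q+j<L)) (cong (bseq d L) (+-suc q j)))
      where
      q+j<L : q + j < L
      q+j<L = ≤-trans (+-monoʳ-< q j<L∸q) (≤-reflexive (m+[n∸m]≡n q≤L))
      descent≡bseq : ∀ j → q + j ≤ L → descent t j ≡ bseq d L (q + j)
      descent≡bseq j q+j≤L = trans (cong (λ i → d (q + j) ∸ d i) (+-suc q j)) (sym (bseq≡descent d L d≡0 q+j≤L))

proposition4p4 : (n : ℕ) → 1 ≤ n → (d : ℕ → ℕ) → InΔ n d →
    (L : ℕ) → 0 < d L → (∀ k → L < k → d k ≡ 0) →
    (q : ℕ) → (∀ i → 1 ≤ i → i ≤ q → d i ≡ i) → d (suc q) ≤ q →
    HasCount (λ α → IsPartition n α × numParts α ≡ q × δ α ≈ₛ d)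
      (prodRange q L (λ i → (bseq d L i + bseq d L (suc i)) C bseq d L i))
proposition4p4 n n≥1 d (α′ , α′-partition , δα′≈d) L _ d≡0 zero _ d[1]≤0 =
  contradiction (subst (_≤ 0) (trans (sym (δα′≈d 1 ≤-refl)) (δ-one α′ n≥1 α′-partition)) d[1]≤0) λ ()
proposition4p4 n n≥1 d (α′ , α′-partition , δα′≈d) L _ d≡0 (suc q) d-init d[1+q]≤q =
  classList , classList-unique , ∈-classList , length-classList
  where open Count n d α′ α′-partition δα′≈d L d≡0 (suc q) (s≤s z≤n) d-init d[1+q]≤q
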